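{- For every $m \ge 3$, the odd graph $O_m$ has degree $m$, and there exists $G \le \operatorname{Aut}(O_m)$ with $G \cong S_{2m-1}$ such that $O_m$ is $G$-vertex-primitive and $O_m$ contains a $G$-permutable $m$-matching.
   Context: The odd graph $O_m$ has as vertices the $(m-1)$-element subsets of a $(2m-1)$-element set, two vertices being adjacent iff the subsets are disjoint. $O_m$ is $G$-vertex-primitive if $G$ is transitive on vertices and preserves no partition of the vertex set other than the partition into singletons and the one-block partition. A matching $\mathcal{M}$ with $m$ edges is $G$-permutable if the setwise stabilizer $G_{\mathcal{M}}$ induces the full symmetric group $S_m$ on the edges of $\mathcal{M}$. -}

module Defs where

open import Data.Nat using (ℕ; suc; _+_; _∸_; _*_)
open import Data.Fin using (Fin)
open import Data.Fin.Subset using (Subset; ∣_∣; _∩_; ⊥)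
open import Data.Fin.Permutation using (Permutation′; _⟨$⟩ʳ_; _∘ₚ_) renaming (_≈_ to _≈ₚ_)
open import Data.Product using (Σ; ∃; _×_; _,_; proj₁; proj₂)
open import Data.Sum using (_⊎_)
open import Function.Bundles using (_↔_; _⇔_; Inverse)
open import Relation.Binary.PropositionalEquality using (_≡_; _≢_)

ground : ℕ → ℕ
ground m = 2 * m ∸ 1

V : ℕ → Set
V m = Σ (Subset (ground m)) (λ s → ∣ s ∣ ≡ m ∸ 1)

Adj : (m : ℕ) → V m → V m → Set
Adj m u v = proj₁ u ∩ proj₁ v ≡ ⊥

HasDegree : (m d : ℕ) → Set
HasDegree m d = ∀ (v : V m) → Σ (V m) (Adj m v) ↔ Fin d

record Aut (m : ℕ) : Set where
  field
    perm     : V m ↔ V m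
    preserve : ∀ u v → Adj m u v ⇔ Adj m (Inverse.to perm u) (Inverse.to perm v)

_·_ : ∀ {m} → Aut m → V m → V m
g · v = Inverse.to (Aut.perm g) v

-- An injective group homomorphism S_{2m-1} → Aut(O_m); its image G is a
-- subgroup of Aut(O_m) isomorphic to S_{2m-1}.  Elements of S_n are
-- permutations of Fin n up to pointwise equality; automorphisms are
-- compared pointwise.  (σ ∘ₚ τ applies σ first, then τ.)
record SymEmbedding (m : ℕ) : Set where
  field
    φ       : Permutation′ (ground m) → Aut m
    φ-resp  : ∀ σ τ → σ ≈ₚ τ → ∀ v → φ σ · v ≡ φ τ · v
    φ-hom   : ∀ σ τ v → φ (σ ∘ₚ τ) · v ≡ φ τ · (φ σ · v)
    φ-inj   : ∀ σ τ → (∀ v → φ σ · v ≡ φ τ · v) → σ ≈ₚ τ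

module _ {m : ℕ} (E : SymEmbedding m) where
  open SymEmbedding E

  Transitive : Set
  Transitive = ∀ u v → ∃ λ σ → φ σ · u ≡ v

  -- A partition of V m is given by a block-labelling c : V m → ℕ
  -- (blocks are the fibres of c).  G preserves it if every element of G
  -- maps blocks to blocks.
  Preserves : (V m → ℕ) → Set
  Preserves c = ∀ σ u v → c u ≡ c v → c (φ σ · u) ≡ c (φ σ · v)

  TrivialPartition : (V m → ℕ) → Set
  TrivialPartition c = (∀ u v → c u ≡ c v → u ≡ v) ⊎ (∀ u v → c u ≡ c v)

  VertexPrimitive : Set
  VertexPrimitive = Transitive × (∀ c → Preserves c → TrivialPartition c)

record Matching (m k : ℕ) : Set where
  field
    a b      : Fin k → V m
    isEdge   : ∀ i → Adj m (a i) (b i)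
    disjoint : ∀ i j → i ≢ j →
               (a i ≢ a j) × (a i ≢ b j) × (b i ≢ a j) × (b i ≢ b j)

module _ {m : ℕ} (E : SymEmbedding m) where
  open SymEmbedding E

  MapsEdge : ∀ {k} → Matching m k → Aut m → Fin k → Fin k → Set
  MapsEdge M g i j =
    ((g · a i ≡ a j) × (g · b i ≡ b j)) ⊎ ((g · a i ≡ b j) × (g · b i ≡ a j))
    where open Matching M

  Permutable : ∀ {k} → Matching m k → Set
  Permutable {k} M = ∀ (π : Permutation′ k) →
    ∃ λ σ → ∀ i → MapsEdge M (φ σ) i (π ⟨$⟩ʳ i)

-- S_{2m-1} acts on (m-1)-subsets by permuting the ground set. The action is faithful,
-- preserves disjointness, and is transitive, since two subsets of the same size are
-- joined by a chain of transpositions. For primitivity, take a block B ∋ x. If B also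
-- contains x(a b) for some a ∈ x, b ∉ x, then conjugating by transpositions fixing x
-- puts every x(i j) into B, and chains of transpositions put every vertex into B.
-- Otherwise B = {x}: two distinct u, v in one block have some a ∈ u ∖ v and, as
-- 2(m-1) < 2m-1, a common non-member b; then (a b) fixes v, so u(a b) lies in the
-- block of u, which is the first case. The degree is computed at {0,…,m-2}, whose
-- neighbours are the last m points minus one. For a fixed (m-2)-subset Y of the
-- first m-1 points, S_m acting on the last m points permutes the m edges
-- {Y ∪ {i}, (last m points) ∖ {i}} arbitrarily.

module Submission where

open import Defs
open import Data.Nat using (ℕ; zero; suc; _+_; _∸_; _<_; _≤_; _≥_; z≤n; s≤s)
open import Data.Bool using (true; false; not; _∧_; if_then_else_)
open import Data.Fin using (Fin; zero; suc; _≟_)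
open import Data.Fin.Subset using (Subset; ∣_∣; _∩_; ⊥; ⊤; ∁; ⁅_⁆)
open import Data.Fin.Subset.Properties
  using (x∈⁅x⁆; x∈⁅y⁆⇒x≡y; ∣p∣≤n; ∣p∣≤∣x∷p∣; ∣p∣≡n⇒p≡⊤; ∣⊤∣≡n; ∣⊥∣≡0; ∣⁅x⁆∣≡1; ∣∁p∣≡n∸∣p∣; ∩-zeroˡ; ∩-zeroʳ; ∩-identityˡ; ∩-inverseʳ)
open import Data.Fin.Permutation
  using (Permutation′; _⟨$⟩ʳ_; _⟨$⟩ˡ_; _∘ₚ_; flip; inverseˡ; inverseʳ; transpose; lift₀; lift₀-transpose)
  renaming (_≈_ to _≈ₚ_; id to idₚ)
import Data.Fin.Permutation.Components as PC
open import Data.Vec using (Vec; []; _∷_; lookup; tabulate; map; zipWith; replicate; _[_]≔_; _++_; take; drop)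
open import Data.Vec.Properties
  using (lookup∘tabulate; tabulate∘lookup; tabulate-cong; lookup-zipWith; lookup-replicate; lookup-map;
         []=⇒lookup; lookup⇒[]=; lookup∘update; lookup∘update′; []≔-idempotent; []≔-lookup; ≡-dec;
         take++drop≡id; ++-injectiveˡ; ++-injectiveʳ; zipWith-++)
import Data.Nat.Properties as ℕ
open import Algebra.Properties.CommutativeMonoid.Sum ℕ.+-0-commutativeMonoid using (sum; sum-permute; sum-cong-≗)
open import Relation.Nullary using (yes; no; contradiction)
open import Data.Sum using (_⊎_; inj₁; inj₂)
open import Data.Product using (Σ; ∃; ∃₂; _×_; _,_; proj₁; proj₂)
import Data.Bool.Properties as Bool
open import Relation.Binary using (DecidableEquality)
open import Relation.Binary.Construct.Closure.ReflexiveTransitive using (Star; ε; _◅_; _◅◅_; gmap; fold)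
open import Function.Bundles using (_↔_; mk↔ₛ′; mk⇔)
open import Function.Properties.Inverse using (↔-trans)
open import Axiom.UniquenessOfIdentityProofs using (module Decidable⇒UIP)
open import Relation.Binary.PropositionalEquality
open import Function using (_∘_; case_of_)

variable
  n k : ℕ
  A B C : Set

lookup-≗⇒≡ : ∀ {xs ys : Vec A n} → (∀ i → lookup xs i ≡ lookup ys i) → xs ≡ ys
lookup-≗⇒≡ {xs = xs} {ys} eq = begin
  xs                 ≡⟨ tabulate∘lookup xs ⟨
  tabulate (lookup xs) ≡⟨ tabulate-cong eq ⟩
  tabulate (lookup ys) ≡⟨ tabulate∘lookup ys ⟩
  ys                 ∎
  where open ≡-Reasoning

lookup-⁅⁆-self : ∀ (i : Fin n) → lookup ⁅ i ⁆ i ≡ true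
lookup-⁅⁆-self i = []=⇒lookup (x∈⁅x⁆ i)

lookup-⁅⁆⇒≡ : ∀ (i t : Fin n) → lookup ⁅ i ⁆ t ≡ true → t ≡ i
lookup-⁅⁆⇒≡ i t e = x∈⁅y⁆⇒x≡y i (lookup⇒[]= t ⁅ i ⁆ e)

lookup-⁅⁆-other : ∀ (i t : Fin n) → t ≢ i → lookup ⁅ i ⁆ t ≡ false
lookup-⁅⁆-other i t t≢i with lookup ⁅ i ⁆ t in e
... | true  = contradiction (lookup-⁅⁆⇒≡ i t e) t≢i
... | false = refl

-- Permuting coordinates

act : Permutation′ n → Vec A n → Vec A n
act σ xs = tabulate (λ j → lookup xs (σ ⟨$⟩ˡ j))

lookup-act : ∀ (σ : Permutation′ n) (xs : Vec A n) j → lookup (act σ xs) j ≡ lookup xs (σ ⟨$⟩ˡ j)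
lookup-act σ xs j = lookup∘tabulate _ j

act-∘ₚ : ∀ (σ τ : Permutation′ n) (xs : Vec A n) → act (σ ∘ₚ τ) xs ≡ act τ (act σ xs)
act-∘ₚ σ τ xs = lookup-≗⇒≡ λ j → trans (lookup-act (σ ∘ₚ τ) xs j) (sym (trans (lookup-act τ (act σ xs) j) (lookup-act σ xs (τ ⟨$⟩ˡ j))))

act-id : ∀ (xs : Vec A n) → act idₚ xs ≡ xs
act-id xs = lookup-≗⇒≡ (lookup-act idₚ xs)

act-flipˡ : ∀ (σ : Permutation′ n) (xs : Vec A n) → act (flip σ) (act σ xs) ≡ xs
act-flipˡ σ xs = lookup-≗⇒≡ λ j →
  trans (lookup-act (flip σ) (act σ xs) j) (trans (lookup-act σ xs (σ ⟨$⟩ʳ j)) (cong (lookup xs) (inverseˡ σ)))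

act-flipʳ : ∀ (σ : Permutation′ n) (xs : Vec A n) → act σ (act (flip σ) xs) ≡ xs
act-flipʳ σ xs = lookup-≗⇒≡ λ j →
  trans (lookup-act σ (act (flip σ) xs) j) (trans (lookup-act (flip σ) xs (σ ⟨$⟩ˡ j)) (cong (lookup xs) (inverseʳ σ)))

act-cong : ∀ {σ τ : Permutation′ n} → σ ≈ₚ τ → ∀ (xs : Vec A n) → act σ xs ≡ act τ xs
act-cong {σ = σ} {τ} σ≈τ xs = lookup-≗⇒≡ λ j →
  trans (lookup-act σ xs j) (trans (cong (lookup xs) (σ⁻¹≡τ⁻¹ j)) (sym (lookup-act τ xs j)))
  where
  σ⁻¹≡τ⁻¹ : ∀ j → σ ⟨$⟩ˡ j ≡ τ ⟨$⟩ˡ j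
  σ⁻¹≡τ⁻¹ j = trans (cong (σ ⟨$⟩ˡ_) (trans (sym (inverseʳ τ)) (sym (σ≈τ _)))) (inverseˡ σ)

act-map : ∀ (f : A → B) (σ : Permutation′ n) xs → act σ (map f xs) ≡ map f (act σ xs)
act-map f σ xs = lookup-≗⇒≡ λ j →
  trans (lookup-act σ (map f xs) j) (trans (lookup-map (σ ⟨$⟩ˡ j) f xs)
    (sym (trans (lookup-map j f (act σ xs)) (cong f (lookup-act σ xs j)))))

act-zipWith : ∀ (f : A → B → C) (σ : Permutation′ n) xs ys →
              act σ (zipWith f xs ys) ≡ zipWith f (act σ xs) (act σ ys)
act-zipWith f σ xs ys = lookup-≗⇒≡ λ j →
  trans (lookup-act σ (zipWith f xs ys) j) (trans (lookup-zipWith f (σ ⟨$⟩ˡ j) xs ys)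
    (sym (trans (lookup-zipWith f j (act σ xs) (act σ ys)) (cong₂ f (lookup-act σ xs j) (lookup-act σ ys j)))))

act-replicate : ∀ {n} (σ : Permutation′ n) (x : A) → act σ (replicate n x) ≡ replicate n x
act-replicate {n = n} σ x = lookup-≗⇒≡ λ j →
  trans (lookup-act σ (replicate n x) j) (trans (lookup-replicate (σ ⟨$⟩ˡ j) x) (sym (lookup-replicate j x)))

act-⁅⁆ : ∀ (σ : Permutation′ n) i → act σ ⁅ i ⁆ ≡ ⁅ σ ⟨$⟩ʳ i ⁆
act-⁅⁆ σ i = lookup-≗⇒≡ λ t → trans (lookup-act σ ⁅ i ⁆ t) (pointwise t)
  where
  pointwise : ∀ t → lookup ⁅ i ⁆ (σ ⟨$⟩ˡ t) ≡ lookup ⁅ σ ⟨$⟩ʳ i ⁆ t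
  pointwise t with t ≟ σ ⟨$⟩ʳ i
  ... | yes refl = trans (cong (lookup ⁅ i ⁆) (inverseˡ σ)) (trans (lookup-⁅⁆-self i) (sym (lookup-⁅⁆-self t)))
  ... | no t≢σi = trans (lookup-⁅⁆-other i _ (λ e → t≢σi (trans (sym (inverseʳ σ)) (cong (σ ⟨$⟩ʳ_) e))))
                        (sym (lookup-⁅⁆-other _ t t≢σi))

∣p∣≡sum : ∀ (p : Subset n) → ∣ p ∣ ≡ sum (λ i → if lookup p i then 1 else 0)
∣p∣≡sum []          = refl
∣p∣≡sum (true  ∷ p) = cong suc (∣p∣≡sum p)
∣p∣≡sum (false ∷ p) = ∣p∣≡sum p

∣act∣ : ∀ (σ : Permutation′ n) p → ∣ act σ p ∣ ≡ ∣ p ∣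
∣act∣ σ p = begin
  ∣ act σ p ∣                                        ≡⟨ ∣p∣≡sum (act σ p) ⟩
  sum (λ j → if lookup (act σ p) j then 1 else 0)     ≡⟨ sum-cong-≗ (λ j → cong (if_then 1 else 0) (lookup-act σ p j)) ⟩
  sum (λ j → if lookup p (σ ⟨$⟩ˡ j) then 1 else 0)    ≡⟨ sum-permute _ (flip σ) ⟨
  sum (λ i → if lookup p i then 1 else 0)             ≡⟨ ∣p∣≡sum p ⟨
  ∣ p ∣                                              ∎
  where open ≡-Reasoning

-- Transpositions

transpose-at-i : ∀ (i j : Fin n) → PC.transpose i j i ≡ j
transpose-at-i i j with i ≟ i
... | yes _   = refl
... | no i≢i = contradiction refl i≢i

transpose-at-j : ∀ (i j : Fin n) → PC.transpose i j j ≡ i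
transpose-at-j i j with j ≟ i
... | yes j≡i = j≡i
... | no _ with j ≟ j
...   | yes _   = refl
...   | no j≢j = contradiction refl j≢j

transpose-apart : ∀ {i j t : Fin n} → t ≢ i → t ≢ j → PC.transpose i j t ≡ t
transpose-apart {i = i} {j} {t} t≢i t≢j with t ≟ i
... | yes t≡i = contradiction t≡i t≢i
... | no _ with t ≟ j
...   | yes t≡j = contradiction t≡j t≢j
...   | no _    = refl

data Position (i j : Fin n) : Fin n → Set where
  at-i  : Position i j i
  at-j  : j ≢ i → Position i j j
  apart : ∀ {t} → t ≢ i → t ≢ j → Position i j t

position : ∀ (i j t : Fin n) → Position i j t
position i j t with t ≟ i | t ≟ j
... | yes refl | _        = at-i
... | no t≢i   | yes refl = at-j t≢i
... | no t≢i   | no t≢j   = apart t≢i t≢j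

transpose-comm : ∀ (i j t : Fin n) → PC.transpose i j t ≡ PC.transpose j i t
transpose-comm i j t with position i j t
... | at-i        = trans (transpose-at-i t j) (sym (transpose-at-j j t))
... | at-j _      = trans (transpose-at-j i t) (sym (transpose-at-i t i))
... | apart t≢i t≢j = trans (transpose-apart t≢i t≢j) (sym (transpose-apart t≢j t≢i))

transpose-involutive : ∀ (i j t : Fin n) → PC.transpose i j (PC.transpose i j t) ≡ t
transpose-involutive i j t = trans (cong (PC.transpose i j) (transpose-comm i j t)) (PC.transpose-inverse i j)

transpose-conj : ∀ {p q r : Fin n} → p ≢ q → p ≢ r → q ≢ r → ∀ t →
                 PC.transpose q r (PC.transpose p q (PC.transpose q r t)) ≡ PC.transpose p r t
transpose-conj {p = p} {q} {r} p≢q p≢r q≢r t with position q r t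
... | at-i = begin
  PC.transpose q r (PC.transpose p q (PC.transpose q r q)) ≡⟨ cong (λ u → PC.transpose q r (PC.transpose p q u)) (transpose-at-i q r) ⟩
  PC.transpose q r (PC.transpose p q r)                   ≡⟨ cong (PC.transpose q r) (transpose-apart (p≢r ∘ sym) (q≢r ∘ sym)) ⟩
  PC.transpose q r r                                     ≡⟨ transpose-at-j q r ⟩
  q                                                      ≡⟨ transpose-apart (p≢q ∘ sym) q≢r ⟨
  PC.transpose p r q                                     ∎
  where open ≡-Reasoning
... | at-j _ = begin
  PC.transpose q r (PC.transpose p q (PC.transpose q r r)) ≡⟨ cong (λ u → PC.transpose q r (PC.transpose p q u)) (transpose-at-j q r) ⟩
  PC.transpose q r (PC.transpose p q q)                   ≡⟨ cong (PC.transpose q r) (transpose-at-j p q) ⟩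
  PC.transpose q r p                                     ≡⟨ transpose-apart p≢q p≢r ⟩
  p                                                      ≡⟨ transpose-at-j p r ⟨
  PC.transpose p r r                                     ∎
  where open ≡-Reasoning
... | apart t≢q t≢r with position p q t
...   | at-i = begin
  PC.transpose q r (PC.transpose p q (PC.transpose q r p)) ≡⟨ cong (λ u → PC.transpose q r (PC.transpose p q u)) (transpose-apart t≢q t≢r) ⟩
  PC.transpose q r (PC.transpose p q p)                   ≡⟨ cong (PC.transpose q r) (transpose-at-i p q) ⟩
  PC.transpose q r q                                     ≡⟨ transpose-at-i q r ⟩
  r                                                      ≡⟨ transpose-at-i p r ⟨
  PC.transpose p r p                                     ∎
  where open ≡-Reasoning
...   | at-j _ = contradiction refl t≢q
...   | apart t≢p _ = begin
  PC.transpose q r (PC.transpose p q (PC.transpose q r t)) ≡⟨ cong (λ u → PC.transpose q r (PC.transpose p q u)) (transpose-apart t≢q t≢r) ⟩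
  PC.transpose q r (PC.transpose p q t)                   ≡⟨ cong (PC.transpose q r) (transpose-apart t≢p t≢q) ⟩
  PC.transpose q r t                                     ≡⟨ transpose-apart t≢q t≢r ⟩
  t                                                      ≡⟨ transpose-apart t≢p t≢r ⟨
  PC.transpose p r t                                     ∎
  where open ≡-Reasoning

lookup-act-transpose : ∀ (i j : Fin n) (xs : Vec A n) t →
                       lookup (act (transpose i j) xs) t ≡ lookup xs (PC.transpose i j t)
lookup-act-transpose i j xs t = trans (lookup-act (transpose i j) xs t) (cong (lookup xs) (transpose-comm j i t))

act-transpose-comm : ∀ (i j : Fin n) (xs : Vec A n) → act (transpose i j) xs ≡ act (transpose j i) xs
act-transpose-comm i j xs = lookup-≗⇒≡ λ t →
  trans (lookup-act-transpose i j xs t) (trans (cong (lookup xs) (transpose-comm i j t)) (sym (lookup-act-transpose j i xs t)))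

act-transpose-fix : ∀ (i j : Fin n) (xs : Vec A n) → lookup xs i ≡ lookup xs j → act (transpose i j) xs ≡ xs
act-transpose-fix i j xs xsᵢ≡xsⱼ = lookup-≗⇒≡ λ t → trans (lookup-act-transpose i j xs t) (fixed t)
  where
  fixed : ∀ t → lookup xs (PC.transpose i j t) ≡ lookup xs t
  fixed t with position i j t
  ... | at-i          = trans (cong (lookup xs) (transpose-at-i i j)) (sym xsᵢ≡xsⱼ)
  ... | at-j _        = trans (cong (lookup xs) (transpose-at-j i j)) xsᵢ≡xsⱼ
  ... | apart t≢i t≢j = cong (lookup xs) (transpose-apart t≢i t≢j)

act-transpose-conj : ∀ {p q r : Fin n} → p ≢ q → p ≢ r → q ≢ r → ∀ (xs : Vec A n) →
  act (transpose q r) (act (transpose p q) (act (transpose q r) xs)) ≡ act (transpose p r) xs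
act-transpose-conj {p = p} {q} {r} p≢q p≢r q≢r xs = lookup-≗⇒≡ λ t → begin
  lookup (act (transpose q r) (act (transpose p q) (act (transpose q r) xs))) t
    ≡⟨ lookup-act-transpose q r (act (transpose p q) (act (transpose q r) xs)) t ⟩
  lookup (act (transpose p q) (act (transpose q r) xs)) (PC.transpose q r t)
    ≡⟨ lookup-act-transpose p q (act (transpose q r) xs) (PC.transpose q r t) ⟩
  lookup (act (transpose q r) xs) (PC.transpose p q (PC.transpose q r t))
    ≡⟨ lookup-act-transpose q r xs (PC.transpose p q (PC.transpose q r t)) ⟩
  lookup xs (PC.transpose q r (PC.transpose p q (PC.transpose q r t)))
    ≡⟨ cong (lookup xs) (transpose-conj p≢q p≢r q≢r t) ⟩
  lookup xs (PC.transpose p r t)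
    ≡⟨ lookup-act-transpose p r xs t ⟨
  lookup (act (transpose p r) xs) t ∎
  where open ≡-Reasoning

act-transpose-suc : ∀ (i j : Fin n) (x : A) xs →
                    act (transpose (suc i) (suc j)) (x ∷ xs) ≡ x ∷ act (transpose i j) xs
act-transpose-suc i j x xs = act-cong {σ = transpose (suc i) (suc j)} {lift₀ (transpose i j)} (lift₀-transpose i j) (x ∷ xs)

act-transpose-zero : ∀ (j : Fin n) (x : A) xs →
                     act (transpose zero (suc j)) (x ∷ xs) ≡ lookup xs j ∷ (xs [ j ]≔ x)
act-transpose-zero j x xs = lookup-≗⇒≡ λ t → trans (lookup-act-transpose zero (suc j) (x ∷ xs) t) (swapped t)
  where
  swapped : ∀ t → lookup (x ∷ xs) (PC.transpose zero (suc j) t) ≡ lookup (lookup xs j ∷ (xs [ j ]≔ x)) t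
  swapped t with position zero (suc j) t
  ... | at-i            = cong (lookup (x ∷ xs)) (transpose-at-i zero (suc j))
  ... | at-j _          = trans (cong (lookup (x ∷ xs)) (transpose-at-j zero (suc j))) (sym (lookup∘update j xs x))
  ... | apart {zero} z≢z _ = contradiction refl z≢z
  ... | apart {suc t} 1+t≢0 1+t≢1+j = trans (cong (lookup (x ∷ xs)) (transpose-apart 1+t≢0 1+t≢1+j))
                                         (sym (lookup∘update′ (1+t≢1+j ∘ cong suc) xs x))

-- Subsets of a fixed size

∣[]≔false∣ : ∀ (p : Subset n) i → lookup p i ≡ true → suc ∣ p [ i ]≔ false ∣ ≡ ∣ p ∣
∣[]≔false∣ (true  ∷ p) zero    _ = refl
∣[]≔false∣ (true  ∷ p) (suc i) e = cong suc (∣[]≔false∣ p i e)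
∣[]≔false∣ (false ∷ p) (suc i) e = ∣[]≔false∣ p i e

∣[]≔true∣ : ∀ (p : Subset n) i → lookup p i ≡ false → ∣ p [ i ]≔ true ∣ ≡ suc ∣ p ∣
∣[]≔true∣ (false ∷ p) zero    _ = refl
∣[]≔true∣ (true  ∷ p) (suc i) e = cong suc (∣[]≔true∣ p i e)
∣[]≔true∣ (false ∷ p) (suc i) e = ∣[]≔true∣ p i e

∃-inside : ∀ (p : Subset n) → 0 < ∣ p ∣ → ∃ λ i → lookup p i ≡ true
∃-inside (true  ∷ p) _ = zero , refl
∃-inside (false ∷ p) 0<∣p∣ with i , pᵢ ← ∃-inside p 0<∣p∣ = suc i , pᵢ

∃-outside : ∀ (p : Subset n) → ∣ p ∣ < n → ∃ λ i → lookup p i ≡ false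
∃-outside (false ∷ p) _ = zero , refl
∃-outside (true  ∷ p) (s≤s ∣p∣<n) with i , pᵢ ← ∃-outside p ∣p∣<n = suc i , pᵢ

∃-inside-outside : ∀ (p q : Subset n) → ∣ q ∣ < ∣ p ∣ → ∃ λ a → lookup p a ≡ true × lookup q a ≡ false
∃-inside-outside (true  ∷ p) (false ∷ q) _ = zero , refl , refl
∃-inside-outside (true  ∷ p) (true  ∷ q) (s≤s lt) with a , pₐ , qₐ ← ∃-inside-outside p q lt = suc a , pₐ , qₐ
∃-inside-outside (false ∷ p) (false ∷ q) lt with a , pₐ , qₐ ← ∃-inside-outside p q lt = suc a , pₐ , qₐ
∃-inside-outside (false ∷ p) (true  ∷ q) lt with a , pₐ , qₐ ← ∃-inside-outside p q (ℕ.<-trans (ℕ.n<1+n _) lt) = suc a , pₐ , qₐ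

≢⇒∃-inside-outside : ∀ (p q : Subset n) → ∣ p ∣ ≡ ∣ q ∣ → p ≢ q → ∃ λ a → lookup p a ≡ true × lookup q a ≡ false
≢⇒∃-inside-outside []          []          _  p≢q = contradiction refl p≢q
≢⇒∃-inside-outside (true  ∷ p) (false ∷ q) _  _   = zero , refl , refl
≢⇒∃-inside-outside (true  ∷ p) (true  ∷ q) eq p≢q
  with a , pₐ , qₐ ← ≢⇒∃-inside-outside p q (ℕ.suc-injective eq) (p≢q ∘ cong (true ∷_)) = suc a , pₐ , qₐ
≢⇒∃-inside-outside (false ∷ p) (false ∷ q) eq p≢q
  with a , pₐ , qₐ ← ≢⇒∃-inside-outside p q eq (p≢q ∘ cong (false ∷_)) = suc a , pₐ , qₐ
≢⇒∃-inside-outside (false ∷ p) (true  ∷ q) eq _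
  with a , pₐ , qₐ ← ∃-inside-outside p q (subst (∣ q ∣ <_) (sym eq) (ℕ.n<1+n _)) = suc a , pₐ , qₐ

∃-outside-both : ∀ (p q : Subset n) → ∣ p ∣ + ∣ q ∣ < n → ∃ λ b → lookup p b ≡ false × lookup q b ≡ false
∃-outside-both (false ∷ p) (false ∷ q) _ = zero , refl , refl
∃-outside-both (true ∷ p) (x ∷ q) (s≤s lt)
  with b , p_b , q_b ← ∃-outside-both p q (ℕ.≤-<-trans (ℕ.+-monoʳ-≤ ∣ p ∣ (∣p∣≤∣x∷p∣ x q)) lt) = suc b , p_b , q_b
∃-outside-both {suc n} (false ∷ p) (true ∷ q) lt
  with b , p_b , q_b ← ∃-outside-both p q (ℕ.≤-pred (subst (_< suc n) (ℕ.+-suc ∣ p ∣ ∣ q ∣) lt)) = suc b , p_b , q_b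

KSubset : ℕ → ℕ → Set
KSubset n k = Σ (Subset n) (λ p → ∣ p ∣ ≡ k)

KSubset-≡ : {u v : KSubset n k} → proj₁ u ≡ proj₁ v → u ≡ v
KSubset-≡ {u = p , eq₁} {.p , eq₂} refl = cong (p ,_) (ℕ.≡-irrelevant eq₁ eq₂)

_≟ₖ_ : DecidableEquality (KSubset n k)
u ≟ₖ v with ≡-dec Bool._≟_ (proj₁ u) (proj₁ v)
... | yes eq = yes (KSubset-≡ eq)
... | no neq = no (neq ∘ cong proj₁)

actₖ : Permutation′ n → KSubset n k → KSubset n k
actₖ σ (p , ∣p∣≡k) = act σ p , trans (∣act∣ σ p) ∣p∣≡k

record Swap (p q : Subset n) : Set where
  constructor swap
  field
    i j     : Fin n
    swapped : act (transpose i j) p ≡ q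

Swap-∷ : ∀ x {p q : Subset n} → Swap p q → Swap (x ∷ p) (x ∷ q)
Swap-∷ x {p} (swap i j eq) = swap (suc i) (suc j) (trans (act-transpose-suc i j x p) (cong (x ∷_) eq))

Swap-head : ∀ {x y} (q : Subset n) j → lookup q j ≡ x → Swap (x ∷ (q [ j ]≔ y)) (y ∷ q)
Swap-head {x = x} {y} q j qⱼ≡x = swap zero (suc j) (begin
  act (transpose zero (suc j)) (x ∷ (q [ j ]≔ y)) ≡⟨ act-transpose-zero j x (q [ j ]≔ y) ⟩
  lookup (q [ j ]≔ y) j ∷ ((q [ j ]≔ y) [ j ]≔ x)  ≡⟨ cong₂ _∷_ (lookup∘update j q y) ([]≔-idempotent q j) ⟩
  y ∷ (q [ j ]≔ x)                                ≡⟨ cong (λ z → y ∷ (q [ j ]≔ z)) qⱼ≡x ⟨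
  y ∷ (q [ j ]≔ lookup q j)                       ≡⟨ cong (y ∷_) ([]≔-lookup q j) ⟩
  y ∷ q                                           ∎)
  where open ≡-Reasoning

sameSize⇒Star-Swap : ∀ (p q : Subset n) → ∣ p ∣ ≡ ∣ q ∣ → Star Swap p q
sameSize⇒Star-Swap []          []          _  = ε
sameSize⇒Star-Swap (true  ∷ p) (true  ∷ q) eq = gmap (true ∷_) (Swap-∷ true) (sameSize⇒Star-Swap p q (ℕ.suc-injective eq))
sameSize⇒Star-Swap (false ∷ p) (false ∷ q) eq = gmap (false ∷_) (Swap-∷ false) (sameSize⇒Star-Swap p q eq)
sameSize⇒Star-Swap (true  ∷ p) (false ∷ q) eq
  with j , qⱼ ← ∃-inside q (subst (0 <_) eq (s≤s z≤n)) =
  gmap (true ∷_) (Swap-∷ true) (sameSize⇒Star-Swap p (q [ j ]≔ false) ∣p∣≡∣q′∣) ◅◅ Swap-head q j qⱼ ◅ ε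
  where
  ∣p∣≡∣q′∣ : ∣ p ∣ ≡ ∣ q [ j ]≔ false ∣
  ∣p∣≡∣q′∣ = ℕ.suc-injective (trans eq (sym (∣[]≔false∣ q j qⱼ)))
sameSize⇒Star-Swap {suc n} (false ∷ p) (true ∷ q) eq
  with j , qⱼ ← ∃-outside q (subst (_≤ n) eq (∣p∣≤n p)) =
  gmap (false ∷_) (Swap-∷ false) (sameSize⇒Star-Swap p (q [ j ]≔ true) ∣p∣≡∣q′∣) ◅◅ Swap-head q j qⱼ ◅ ε
  where
  ∣p∣≡∣q′∣ : ∣ p ∣ ≡ ∣ q [ j ]≔ true ∣
  ∣p∣≡∣q′∣ = trans eq (sym (∣[]≔true∣ q j qⱼ))

Star-Swap⇒act : ∀ {n} {p q : Subset n} → Star Swap p q → ∃ λ σ → act σ p ≡ q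
Star-Swap⇒act {n} = fold (λ p q → ∃ λ σ → act σ p ≡ q) prepend (λ {p} → idₚ , act-id p)
  where
  prepend : ∀ {p q r : Subset n} → Swap p q → (∃ λ σ → act σ q ≡ r) → ∃ λ σ → act σ p ≡ r
  prepend {p} (swap i j eq) (σ , σq≡r) = transpose i j ∘ₚ σ , trans (act-∘ₚ (transpose i j) σ p) (trans (cong (act σ) eq) σq≡r)

actₖ-transitive : ∀ (u v : KSubset n k) → ∃ λ σ → actₖ σ u ≡ v
actₖ-transitive u v with σ , σu≡v ← Star-Swap⇒act (sameSize⇒Star-Swap (proj₁ u) (proj₁ v) (trans (proj₂ u) (sym (proj₂ v)))) =
  σ , KSubset-≡ σu≡v

∃-inside-outside-vertex : ∀ (x : KSubset n k) → 0 < k → k < n →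
                          ∃₂ λ a b → lookup (proj₁ x) a ≡ true × lookup (proj₁ x) b ≡ false
∃-inside-outside-vertex {n} (p , ∣p∣≡k) 0<k k<n
  with a , pₐ ← ∃-inside p (subst (0 <_) (sym ∣p∣≡k) 0<k)
     | b , p_b ← ∃-outside p (subst (_< n) (sym ∣p∣≡k) k<n) = a , b , pₐ , p_b

-- Primitivity and faithfulness

module InvariantPartition {n k} (c : KSubset n k → ℕ)
  (c-invariant : ∀ σ u v → c u ≡ c v → c (actₖ σ u) ≡ c (actₖ σ v)) where

  swaps⇒constant : ∀ x → (∀ i j → c x ≡ c (actₖ (transpose i j) x)) → ∀ y → c y ≡ c x
  swaps⇒constant x swaps y = along path x y refl refl refl
    where
    path : Star Swap (proj₁ x) (proj₁ y)
    path = sameSize⇒Star-Swap (proj₁ x) (proj₁ y) (trans (proj₂ x) (sym (proj₂ y)))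
    along : ∀ {p q} → Star Swap p q → ∀ u v → proj₁ u ≡ p → proj₁ v ≡ q → c u ≡ c x → c v ≡ c x
    along ε u v refl v≡u cu≡cx = trans (cong c (KSubset-≡ v≡u)) cu≡cx
    along (swap i j eq ◅ rest) u v refl v≡q cu≡cx =
      along rest (actₖ (transpose i j) u) v eq v≡q
        (trans (c-invariant (transpose i j) u x cu≡cx) (sym (swaps i j)))

  module _ (x : KSubset n k) where

    private
      X : Subset n
      X = proj₁ x

    ∈∉⇒≢ : ∀ {i j} → lookup X i ≡ true → lookup X j ≡ false → i ≢ j
    ∈∉⇒≢ xᵢ xⱼ refl = case trans (sym xᵢ) xⱼ of λ ()

    fixedBy : ∀ {i j} → lookup X i ≡ lookup X j → actₖ (transpose i j) x ≡ x
    fixedBy {i} {j} xᵢ≡xⱼ = KSubset-≡ (act-transpose-fix i j X xᵢ≡xⱼ)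

    conj-class : ∀ (ρ τ : Permutation′ n) → actₖ ρ x ≡ x → c x ≡ c (actₖ τ x) → c x ≡ c (actₖ ρ (actₖ τ x))
    conj-class ρ τ ρx≡x cx≡cτx = trans (cong c (sym ρx≡x)) (c-invariant ρ x (actₖ τ x) cx≡cτx)

    module OneSwap {a b} (xₐ : lookup X a ≡ true) (x_b : lookup X b ≡ false)
                   (cx≡cabx : c x ≡ c (actₖ (transpose a b) x)) where

      outside : ∀ j → lookup X j ≡ false → c x ≡ c (actₖ (transpose a j) x)
      outside j xⱼ with j ≟ b
      ... | yes refl = cx≡cabx
      ... | no j≢b = subst (λ z → c x ≡ c z) (KSubset-≡ conjugate)
                       (conj-class (transpose b j) (transpose a b) bj-fixes cx≡cabx)
        where
        bj-fixes : actₖ (transpose b j) x ≡ x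
        bj-fixes = fixedBy (trans x_b (sym xⱼ))
        conjugate : act (transpose b j) (act (transpose a b) X) ≡ act (transpose a j) X
        conjugate = trans (cong (λ z → act (transpose b j) (act (transpose a b) z)) (sym (cong proj₁ bj-fixes)))
                          (act-transpose-conj (∈∉⇒≢ xₐ x_b) (∈∉⇒≢ xₐ xⱼ) (j≢b ∘ sym) X)

      inside-outside : ∀ i j → lookup X i ≡ true → lookup X j ≡ false → c x ≡ c (actₖ (transpose i j) x)
      inside-outside i j xᵢ xⱼ with i ≟ a
      ... | yes refl = outside j xⱼ
      ... | no i≢a = subst (λ z → c x ≡ c z) (KSubset-≡ conjugate)
                       (conj-class (transpose a i) (transpose a j) ai-fixes (outside j xⱼ))
        where
        ai-fixes : actₖ (transpose a i) x ≡ x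
        ai-fixes = fixedBy (trans xₐ (sym xᵢ))
        conjugate : act (transpose a i) (act (transpose a j) X) ≡ act (transpose i j) X
        conjugate = begin
          act (transpose a i) (act (transpose a j) X)
            ≡⟨ cong (act (transpose a i)) (act-transpose-comm a j X) ⟩
          act (transpose a i) (act (transpose j a) X)
            ≡⟨ cong (λ z → act (transpose a i) (act (transpose j a) z)) (sym (cong proj₁ ai-fixes)) ⟩
          act (transpose a i) (act (transpose j a) (act (transpose a i) X))
            ≡⟨ act-transpose-conj (∈∉⇒≢ xₐ xⱼ ∘ sym) (∈∉⇒≢ xᵢ xⱼ ∘ sym) (i≢a ∘ sym) X ⟩
          act (transpose j i) X
            ≡⟨ act-transpose-comm j i X ⟩
          act (transpose i j) X ∎
          where open ≡-Reasoning

      all : ∀ i j → c x ≡ c (actₖ (transpose i j) x)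
      all i j with lookup X i in xᵢ | lookup X j in xⱼ
      ... | true  | false = inside-outside i j xᵢ xⱼ
      ... | false | true  = trans (inside-outside j i xⱼ xᵢ) (cong c (KSubset-≡ (act-transpose-comm j i X)))
      ... | true  | true  = cong c (sym (fixedBy (trans xᵢ (sym xⱼ))))
      ... | false | false = cong c (sym (fixedBy (trans xᵢ (sym xⱼ))))

    oneSwap⇒constant : ∀ {a b} → lookup X a ≡ true → lookup X b ≡ false →
                       c x ≡ c (actₖ (transpose a b) x) → ∀ y → c y ≡ c x
    oneSwap⇒constant xₐ x_b cx≡cabx = swaps⇒constant x (OneSwap.all xₐ x_b cx≡cabx)

  nonSingleton⇒constant : k + k < n → ∀ u v → u ≢ v → c u ≡ c v → ∀ y → c y ≡ c u
  nonSingleton⇒constant k+k<n u v u≢v cu≡cv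
    with a , uₐ , vₐ ← ≢⇒∃-inside-outside (proj₁ u) (proj₁ v) (trans (proj₂ u) (sym (proj₂ v))) (u≢v ∘ KSubset-≡)
       | b , u_b , v_b ← ∃-outside-both (proj₁ u) (proj₁ v) (subst₂ (λ s t → s + t < n) (sym (proj₂ u)) (sym (proj₂ v)) k+k<n)
    = oneSwap⇒constant u uₐ u_b cu≡cabu
    where
    cu≡cabu : c u ≡ c (actₖ (transpose a b) u)
    cu≡cabu = sym (begin
      c (actₖ (transpose a b) u) ≡⟨ c-invariant (transpose a b) u v cu≡cv ⟩
      c (actₖ (transpose a b) v) ≡⟨ cong c (fixedBy v (trans vₐ (sym v_b))) ⟩
      c v                        ≡⟨ cu≡cv ⟨
      c u                        ∎)
      where open ≡-Reasoning

  trivial : KSubset n k → 0 < k → k + k < n → (∀ u v → c u ≡ c v → u ≡ v) ⊎ (∀ u v → c u ≡ c v)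
  trivial x 0<k k+k<n with a , b , xₐ , x_b ← ∃-inside-outside-vertex x 0<k (ℕ.≤-<-trans (ℕ.m≤m+n k k) k+k<n)
                         | c x ℕ.≟ c (actₖ (transpose a b) x)
  ... | yes cx≡cabx = inj₂ λ u v → trans (oneSwap⇒constant x xₐ x_b cx≡cabx u) (sym (oneSwap⇒constant x xₐ x_b cx≡cabx v))
  ... | no cx≢cabx  = inj₁ λ u v cu≡cv → case u ≟ₖ v of λ where
        (yes u≡v) → u≡v
        (no u≢v)  → contradiction (trans (nonSingleton⇒constant k+k<n u v u≢v cu≡cv x)
                                         (sym (nonSingleton⇒constant k+k<n u v u≢v cu≡cv (actₖ (transpose a b) x))))
                                  cx≢cabx

-- (a i) carries a to i and b to b′; then (b′ i′) carries b′ to i′ and fixes i.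
separatingVertex : ∀ {n k} (x : KSubset n k) {a b} → lookup (proj₁ x) a ≡ true → lookup (proj₁ x) b ≡ false →
                   ∀ {i i′} → i ≢ i′ → ∃ λ y → lookup (proj₁ y) i ≡ true × lookup (proj₁ y) i′ ≡ false
separatingVertex {n} x {a} {b} xₐ x_b {i} {i′} i≢i′ =
  actₖ (transpose b′ i′) (actₖ (transpose a i) x) ,
  trans (moved i) (trans (cong (lookup X ∘ PC.transpose a i) (transpose-apart i≢b′ i≢i′)) (trans (cong (lookup X) (transpose-at-j a i)) xₐ)) ,
  trans (moved i′) (trans (cong (lookup X ∘ PC.transpose a i) (transpose-at-j b′ i′)) (trans (cong (lookup X) (transpose-involutive a i b)) x_b))
  where
  X : Subset n
  X = proj₁ x
  b′ : Fin n
  b′ = PC.transpose a i b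
  i≢b′ : i ≢ b′
  i≢b′ i≡b′ = case trans (sym xₐ) (trans (cong (lookup X) a≡b) x_b) of λ ()
    where
    a≡b : a ≡ b
    a≡b = trans (sym (transpose-at-j a i)) (trans (cong (PC.transpose a i) i≡b′) (transpose-involutive a i b))
  moved : ∀ t → lookup (act (transpose b′ i′) (act (transpose a i) X)) t ≡ lookup X (PC.transpose a i (PC.transpose b′ i′ t))
  moved t = trans (lookup-act-transpose b′ i′ (act (transpose a i) X) t) (lookup-act-transpose a i X (PC.transpose b′ i′ t))

actₖ-faithful : ∀ {n k} → KSubset n k → 0 < k → k < n → ∀ σ τ → (∀ v → actₖ σ v ≡ actₖ τ v) → σ ≈ₚ τ
actₖ-faithful {n} {k} x 0<k k<n σ τ σ≗τ i with a , b , xₐ , x_b ← ∃-inside-outside-vertex x 0<k k<n | σ ⟨$⟩ʳ i ≟ τ ⟨$⟩ʳ i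
... | yes σi≡τi = σi≡τi
... | no σi≢τi =
  case trans (sym inσy) (trans (cong (λ z → lookup z (σ ⟨$⟩ʳ i)) (cong proj₁ (σ≗τ y))) notInτy) of λ ()
  where
  i′ : Fin n
  i′ = τ ⟨$⟩ˡ (σ ⟨$⟩ʳ i)
  i≢i′ : i ≢ i′
  i≢i′ i≡i′ = σi≢τi (sym (trans (cong (τ ⟨$⟩ʳ_) i≡i′) (inverseʳ τ)))
  separating : ∃ λ y → lookup (proj₁ y) i ≡ true × lookup (proj₁ y) i′ ≡ false
  separating = separatingVertex x xₐ x_b i≢i′
  y : KSubset n k
  y = proj₁ separating
  inσy : lookup (act σ (proj₁ y)) (σ ⟨$⟩ʳ i) ≡ true
  inσy = trans (lookup-act σ (proj₁ y) (σ ⟨$⟩ʳ i)) (trans (cong (lookup (proj₁ y)) (inverseˡ σ)) (proj₁ (proj₂ separating)))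
  notInτy : lookup (act τ (proj₁ y)) (σ ⟨$⟩ʳ i) ≡ false
  notInτy = trans (lookup-act τ (proj₁ y) (σ ⟨$⟩ʳ i)) (proj₂ (proj₂ separating))

-- Neighbourhoods and a permutable matching

∣++∣ : ∀ {m} (p : Subset m) (q : Subset n) → ∣ p ++ q ∣ ≡ ∣ p ∣ + ∣ q ∣
∣++∣ []          q = refl
∣++∣ (true  ∷ p) q = cong suc (∣++∣ p q)
∣++∣ (false ∷ p) q = ∣++∣ p q

⊥++⊥ : ∀ m → ⊥ {m} ++ ⊥ {n} ≡ ⊥
⊥++⊥ zero    = refl
⊥++⊥ (suc m) = cong (false ∷_) (⊥++⊥ m)

lookup-∁⁅⁆-self : ∀ (i : Fin n) → lookup (∁ ⁅ i ⁆) i ≡ false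
lookup-∁⁅⁆-self i = trans (lookup-map i not ⁅ i ⁆) (cong not (lookup-⁅⁆-self i))

lookup-∁⁅⁆⇒≡ : ∀ (i t : Fin n) → lookup (∁ ⁅ i ⁆) t ≡ false → t ≡ i
lookup-∁⁅⁆⇒≡ i t e with lookup ⁅ i ⁆ t in eq | lookup-map t not ⁅ i ⁆
... | true  | _  = lookup-⁅⁆⇒≡ i t eq
... | false | e′ = case trans (sym e′) e of λ ()

∣q∣≡n⇒q≡∁⁅i⁆ : ∀ (q : Subset (suc n)) i → lookup q i ≡ false → ∣ q ∣ ≡ n → q ≡ ∁ ⁅ i ⁆
∣q∣≡n⇒q≡∁⁅i⁆ {n} q i qᵢ ∣q∣≡n = lookup-≗⇒≡ pointwise
  where
  filled : q [ i ]≔ true ≡ ⊤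
  filled = ∣p∣≡n⇒p≡⊤ (trans (∣[]≔true∣ q i qᵢ) (cong suc ∣q∣≡n))
  pointwise : ∀ t → lookup q t ≡ lookup (∁ ⁅ i ⁆) t
  pointwise t with t ≟ i
  ... | yes refl = trans qᵢ (sym (lookup-∁⁅⁆-self t))
  ... | no t≢i = begin
    lookup q t                 ≡⟨ lookup∘update′ t≢i q true ⟨
    lookup (q [ i ]≔ true) t   ≡⟨ cong (λ z → lookup z t) filled ⟩
    lookup ⊤ t                 ≡⟨ lookup-replicate t true ⟩
    not false                  ≡⟨ cong not (lookup-⁅⁆-other i t t≢i) ⟨
    not (lookup ⁅ i ⁆ t)        ≡⟨ lookup-map t not ⁅ i ⁆ ⟨
    lookup (∁ ⁅ i ⁆) t          ∎
    where open ≡-Reasoning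

Neighbours : ∀ {n k} → KSubset n k → Set
Neighbours {n} {k} v = Σ (KSubset n k) (λ w → proj₁ v ∩ proj₁ w ≡ ⊥)

Neighbours-≡ : ∀ {v : KSubset n k} {w w′ : Neighbours v} → proj₁ (proj₁ w) ≡ proj₁ (proj₁ w′) → w ≡ w′
Neighbours-≡ {w = (p , ∣p∣≡k) , d} {(.p , ∣p∣≡k′) , d′} refl
  rewrite ℕ.≡-irrelevant ∣p∣≡k ∣p∣≡k′ | Decidable⇒UIP.≡-irrelevant (≡-dec Bool._≟_) d d′ = refl

act-disjoint : ∀ (σ : Permutation′ n) {p q} → p ∩ q ≡ ⊥ → act σ p ∩ act σ q ≡ ⊥
act-disjoint σ {p} {q} p∩q≡⊥ = begin
  act σ p ∩ act σ q ≡⟨ act-zipWith _∧_ σ p q ⟨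
  act σ (p ∩ q)     ≡⟨ cong (act σ) p∩q≡⊥ ⟩
  act σ ⊥           ≡⟨ act-replicate σ false ⟩
  ⊥                 ∎
  where open ≡-Reasoning

Neighbours-act : ∀ (σ : Permutation′ n) (v : KSubset n k) → Neighbours v ↔ Neighbours (actₖ σ v)
Neighbours-act σ v = mk↔ₛ′ forth back (λ w → Neighbours-≡ {v = actₖ σ v} (act-flipʳ σ (proj₁ (proj₁ w))))
                                      (λ w → Neighbours-≡ {v = v} (act-flipˡ σ (proj₁ (proj₁ w))))
  where
  forth : Neighbours v → Neighbours (actₖ σ v)
  forth (w , d) = actₖ σ w , act-disjoint σ d
  back : Neighbours (actₖ σ v) → Neighbours v
  back (w , d) = actₖ (flip σ) w , subst (λ p → p ∩ act (flip σ) (proj₁ w) ≡ ⊥) (act-flipˡ σ (proj₁ v)) (act-disjoint (flip σ) d)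

canonical : ∀ k → KSubset (k + suc k) k
canonical k = ⊤ {k} ++ ⊥ {suc k} , trans (∣++∣ (⊤ {k}) (⊥ {suc k})) (trans (cong₂ _+_ (∣⊤∣≡n k) (∣⊥∣≡0 (suc k))) (ℕ.+-identityʳ k))

allBut : ∀ m (i : Fin (suc k)) → KSubset (m + suc k) k
allBut {k} m i = ⊥ {m} ++ ∁ ⁅ i ⁆ , (begin
  ∣ ⊥ {m} ++ ∁ ⁅ i ⁆ ∣       ≡⟨ ∣++∣ (⊥ {m}) (∁ ⁅ i ⁆) ⟩
  ∣ ⊥ {m} ∣ + ∣ ∁ ⁅ i ⁆ ∣     ≡⟨ cong₂ _+_ (∣⊥∣≡0 m) (∣∁p∣≡n∸∣p∣ ⁅ i ⁆) ⟩
  suc k ∸ ∣ ⁅ i ⁆ ∣           ≡⟨ cong (suc k ∸_) (∣⁅x⁆∣≡1 i) ⟩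
  k                         ∎)
  where open ≡-Reasoning

Neighbours-canonical : ∀ k → Neighbours (canonical k) ↔ Fin (suc k)
Neighbours-canonical k = mk↔ₛ′ missing neighbour missing-neighbour neighbour-missing
  where
  P : Subset (k + suc k)
  P = proj₁ (canonical k)
  neighbour : Fin (suc k) → Neighbours (canonical k)
  neighbour i = allBut k i , disjoint
    where
    disjoint : P ∩ (⊥ {k} ++ ∁ ⁅ i ⁆) ≡ ⊥
    disjoint = trans (zipWith-++ _∧_ (⊤ {k}) (⊥ {suc k}) (⊥ {k}) (∁ ⁅ i ⁆)) (trans (cong₂ _++_ (∩-zeroʳ ⊤) (∩-zeroˡ (∁ ⁅ i ⁆))) (⊥++⊥ {n = suc k} k))
  head≡⊥ : ∀ (w : Neighbours (canonical k)) → take k (proj₁ (proj₁ w)) ≡ ⊥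
  head≡⊥ ((p , _) , d) = ++-injectiveˡ (take k p) ⊥ (begin
    take k p ++ ⊥ {suc k}                        ≡⟨ cong₂ _++_ (∩-identityˡ (take k p)) (∩-zeroˡ (drop k p)) ⟨
    (⊤ ∩ take k p) ++ (⊥ ∩ drop k p)      ≡⟨ zipWith-++ _∧_ ⊤ (⊥ {suc k}) (take k p) (drop k p) ⟨
    P ∩ (take k p ++ drop k p)            ≡⟨ cong (P ∩_) (take++drop≡id k p) ⟩
    P ∩ p                                 ≡⟨ d ⟩
    ⊥                                     ≡⟨ ⊥++⊥ k ⟨
    ⊥ {k} ++ ⊥ {suc k}                    ∎)
    where open ≡-Reasoning
  ∣tail∣ : ∀ (w : Neighbours (canonical k)) → ∣ drop k (proj₁ (proj₁ w)) ∣ ≡ k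
  ∣tail∣ w@((p , ∣p∣≡k) , _) = begin
    ∣ drop k p ∣                       ≡⟨ cong (_+ ∣ drop k p ∣) (trans (cong ∣_∣ (head≡⊥ w)) (∣⊥∣≡0 k)) ⟨
    ∣ take k p ∣ + ∣ drop k p ∣        ≡⟨ ∣++∣ (take k p) (drop k p) ⟨
    ∣ take k p ++ drop k p ∣           ≡⟨ cong ∣_∣ (take++drop≡id k p) ⟩
    ∣ p ∣                              ≡⟨ ∣p∣≡k ⟩
    k                                  ∎
    where open ≡-Reasoning
  outsideTail : ∀ (w : Neighbours (canonical k)) → ∃ λ i → lookup (drop k (proj₁ (proj₁ w))) i ≡ false
  outsideTail w = ∃-outside (drop k (proj₁ (proj₁ w))) (subst (_< suc k) (sym (∣tail∣ w)) (ℕ.n<1+n k))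
  missing : Neighbours (canonical k) → Fin (suc k)
  missing w = proj₁ (outsideTail w)
  missing-neighbour : ∀ i → missing (neighbour i) ≡ i
  missing-neighbour i = lookup-∁⁅⁆⇒≡ i _ (subst (λ q → lookup q (missing (neighbour i)) ≡ false)
    (++-injectiveʳ (take k (⊥ {k} ++ ∁ ⁅ i ⁆)) ⊥ (take++drop≡id k (⊥ {k} ++ ∁ ⁅ i ⁆))) (proj₂ (outsideTail (neighbour i))))
  neighbour-missing : ∀ w → neighbour (missing w) ≡ w
  neighbour-missing w@((p , _) , _) = Neighbours-≡ {v = canonical k} (begin
    ⊥ {k} ++ ∁ ⁅ missing w ⁆      ≡⟨ cong₂ _++_ (head≡⊥ w) (∣q∣≡n⇒q≡∁⁅i⁆ (drop k p) (missing w) (proj₂ (outsideTail w)) (∣tail∣ w)) ⟨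
    take k p ++ drop k p      ≡⟨ take++drop≡id k p ⟩
    p                         ∎)
    where open ≡-Reasoning

degree : ∀ k (v : KSubset (k + suc k) k) → Neighbours v ↔ Fin (suc k)
degree k v with σ , σv≡c ← actₖ-transitive v (canonical k) =
  ↔-trans (Neighbours-act σ v) (subst (λ u → Neighbours u ↔ Fin (suc k)) (sym σv≡c) (Neighbours-canonical k))

lift₀ⁿ : ∀ m → Permutation′ n → Permutation′ (m + n)
lift₀ⁿ zero    π = π
lift₀ⁿ (suc m) π = lift₀ (lift₀ⁿ m π)

act-lift₀ⁿ : ∀ {m} (π : Permutation′ n) (xs : Vec A m) ys → act (lift₀ⁿ m π) (xs ++ ys) ≡ xs ++ act π ys
act-lift₀ⁿ π []       ys = refl
act-lift₀ⁿ π (x ∷ xs) ys = cong (x ∷_) (act-lift₀ⁿ π xs ys)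

record PermutableMatching (n k : ℕ) : Set where
  field
    left right : Fin (suc k) → KSubset n k
    isEdge     : ∀ i → proj₁ (left i) ∩ proj₁ (right i) ≡ ⊥
    disjoint   : ∀ i j → i ≢ j → (left i ≢ left j) × (left i ≢ right j) × (right i ≢ left j) × (right i ≢ right j)
    permute    : ∀ (π : Permutation′ (suc k)) → ∃ λ σ → ∀ i →
                 actₖ σ (left i) ≡ left (π ⟨$⟩ʳ i) × actₖ σ (right i) ≡ right (π ⟨$⟩ʳ i)

-- Y ≢ ⊥ separates the two sides of the matching; it needs K ≥ 2, i.e. m ≥ 3.
matching : ∀ j → PermutableMatching (suc (suc j) + suc (suc (suc j))) (suc (suc j))
matching j = record
  { left     = left
  ; right    = allBut K
  ; isEdge   = λ i → trans (zipWith-++ _∧_ Y ⁅ i ⁆ (⊥ {K}) (∁ ⁅ i ⁆)) (trans (cong₂ _++_ (∩-zeroʳ Y) (∩-inverseʳ ⁅ i ⁆)) (⊥++⊥ K))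
  ; disjoint = λ i i′ i≢i′ → (i≢i′ ∘ left-injective) , Y≢⊥ ∘ left≡right , (Y≢⊥ ∘ left≡right ∘ sym) , (i≢i′ ∘ right-injective)
  ; permute  = λ π → lift₀ⁿ K π , λ i →
      KSubset-≡ (trans (act-lift₀ⁿ π Y ⁅ i ⁆) (cong (Y ++_) (act-⁅⁆ π i))) ,
      KSubset-≡ (trans (act-lift₀ⁿ π (⊥ {K}) (∁ ⁅ i ⁆)) (cong (⊥ {K} ++_) (trans (act-map not π ⁅ i ⁆) (cong ∁ (act-⁅⁆ π i)))))
  }
  where
  K : ℕ
  K = suc (suc j)
  Y : Subset K
  Y = false ∷ ⊤
  left : Fin (suc K) → KSubset (K + suc K) K
  left i = Y ++ ⁅ i ⁆ , trans (∣++∣ Y ⁅ i ⁆) (trans (cong₂ _+_ (∣⊤∣≡n (suc j)) (∣⁅x⁆∣≡1 i)) (ℕ.+-comm (suc j) 1))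
  Y≢⊥ : Y ≢ ⊥
  Y≢⊥ Y≡⊥ = case cong (λ p → lookup p (suc zero)) Y≡⊥ of λ ()
  left≡right : ∀ {i i′} → left i ≡ allBut K i′ → Y ≡ ⊥
  left≡right e = ++-injectiveˡ Y ⊥ (cong proj₁ e)
  left-injective : ∀ {i i′} → left i ≡ left i′ → i ≡ i′
  left-injective {i} {i′} e =
    lookup-⁅⁆⇒≡ i′ i (trans (cong (λ p → lookup p i) (sym (++-injectiveʳ Y Y (cong proj₁ e)))) (lookup-⁅⁆-self i))
  right-injective : ∀ {i i′} → allBut K i ≡ allBut K i′ → i ≡ i′
  right-injective {i} {i′} e =
    lookup-∁⁅⁆⇒≡ i′ i (trans (cong (λ p → lookup p i) (sym (++-injectiveʳ (⊥ {K}) ⊥ (cong proj₁ e)))) (lookup-∁⁅⁆-self i))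

actAut : ∀ {m} → Permutation′ (ground m) → Aut m
actAut σ = record
  { perm     = mk↔ₛ′ (actₖ σ) (actₖ (flip σ)) (λ v → KSubset-≡ (act-flipʳ σ (proj₁ v))) (λ v → KSubset-≡ (act-flipˡ σ (proj₁ v)))
  ; preserve = λ u v → mk⇔ (act-disjoint σ)
      (subst₂ (λ p q → p ∩ q ≡ ⊥) (act-flipˡ σ (proj₁ u)) (act-flipˡ σ (proj₁ v)) ∘ act-disjoint (flip σ))
  }

symEmbedding : ∀ {m} → V m → 0 < m ∸ 1 → m ∸ 1 < ground m → SymEmbedding m
symEmbedding x 0<k k<n = record
  { φ      = actAut
  ; φ-resp = λ σ τ σ≈τ v → KSubset-≡ (act-cong {σ = σ} {τ} σ≈τ (proj₁ v))
  ; φ-hom  = λ σ τ v → KSubset-≡ (act-∘ₚ σ τ (proj₁ v))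
  ; φ-inj  = actₖ-faithful x 0<k k<n
  }

ground-suc : ∀ k → ground (suc k) ≡ k + suc k
ground-suc k = cong (k +_) (ℕ.+-identityʳ (suc k))

theorem3p7 : ∀ (m : ℕ) → m ≥ 3 →
    HasDegree m m ×
    Σ (SymEmbedding m) (λ E →
      VertexPrimitive E × Σ (Matching m m) (λ M → Permutable E M))
theorem3p7 (suc (suc (suc j))) (s≤s (s≤s (s≤s z≤n))) =
  subst (λ n → ∀ (v : KSubset n K) → Neighbours v ↔ Fin (suc K)) (sym n≡) (degree K) ,
  E , (actₖ-transitive , λ c c-inv → InvariantPartition.trivial c c-inv x (s≤s z≤n) K+K<n) ,
  record { a = left ; b = right ; isEdge = isEdge ; disjoint = disjoint } ,
  λ π → proj₁ (permute π) , inj₁ ∘ proj₂ (permute π)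
  where
  K : ℕ
  K = suc (suc j)
  n≡ : ground (suc K) ≡ K + suc K
  n≡ = ground-suc K
  x : KSubset (ground (suc K)) K
  x = subst (λ n → KSubset n K) (sym n≡) (canonical K)
  K+K<n : K + K < ground (suc K)
  K+K<n = subst (K + K <_) (sym n≡) (ℕ.+-monoʳ-< K (ℕ.n<1+n K))
  E : SymEmbedding (suc K)
  E = symEmbedding x (s≤s z≤n) (ℕ.≤-<-trans (ℕ.m≤m+n K K) K+K<n)
  open PermutableMatching (subst (λ n → PermutableMatching n K) (sym n≡) (matching j))
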